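{- Let $\mathcal{C}\subseteq\mathbb{Z}_2^\alpha\times\mathbb{Z}_2[u]^\beta$ be a $\mathbb{Z}_2\mathbb{Z}_2[u]$-additive code and let $C=\Psi(\mathcal{C})$. Then $\Psi(\mathcal{C}^\perp)=C^\perp$, where $C^\perp$ is the usual binary dual code of $C$ (with respect to the standard inner product on $\mathbb{Z}_2^{\alpha+2\beta}$).
   Context: Let $\mathbb{Z}_2[u]=\{0,1,u,1+u\}$ be the ring $\mathbb{Z}_2+u\mathbb{Z}_2$ with $u^2=0$. Define $\pi:\mathbb{Z}_2[u]\to\mathbb{Z}_2$ by $\pi(0)=\pi(u)=0$, $\pi(1)=\pi(1+u)=1$. The set $\mathbb{Z}_2^\alpha\times\mathbb{Z}_2[u]^\beta$ is a $\mathbb{Z}_2[u]$-module under componentwise addition and the scalar multiplication $\lambda(x_1,\dots,x_\alpha\mid x'_1,\dots,x'_\beta)=(\pi(\lambda)x_1,\dots,\pi(\lambda)x_\alpha\mid \lambda x'_1,\dots,\lambda x'_\beta)$. A $\mathbb{Z}_2\mathbb{Z}_2[u]$-additive code is a $\mathbb{Z}_2[u]$-submodule of $\mathbb{Z}_2^\alpha\times\mathbb{Z}_2[u]^\beta$. Let $\psi:\mathbb{Z}_2[u]\to\mathbb{Z}_2^2$ be given by $\psi(0)=(0,0)$, $\psi(1)=(0,1)$, $\psi(u)=(1,1)$, $\psi(1+u)=(1,0)$, extended coordinatewise, and let $\Psi(x\mid x')=(x\mid\psi(x'))\in\mathbb{Z}_2^{\alpha+2\beta}$. The inner product of $\mathbf{x}=(x\mid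 x')$ and $\mathbf{y}=(y\mid y')$ in $\mathbb{Z}_2^\alpha\times\mathbb{Z}_2[u]^\beta$ is $\mathbf{x}\cdot\mathbf{y}=u\left(\sum_{i=1}^\alpha x_iy_i\right)+\sum_{j=1}^\beta x'_jy'_j\in\mathbb{Z}_2[u]$, where binary entries $0,1$ are regarded as the elements $0,1$ of $\mathbb{Z}_2[u]$. The dual is $\mathcal{C}^\perp=\{\mathbf{v}\in\mathbb{Z}_2^\alpha\times\mathbb{Z}_2[u]^\beta:\mathbf{c}\cdot\mathbf{v}=0\text{ for all }\mathbf{c}\in\mathcal{C}\}$. -}

module Defs where

open import Data.Bool using (Bool; true; false; _xor_; _∧_)
open import Data.Nat using (ℕ; zero; suc; _+_; _*_)
open import Data.Vec using (Vec; []; _∷_; _++_; replicate; zipWith; map; foldr; concat)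
open import Data.Product using (Σ; _×_; _,_; ∃)
open import Relation.Binary.PropositionalEquality using (_≡_)

data Z2u : Set where
  𝟎 𝟏 𝐮 𝟏+𝐮 : Z2u

infixl 6 _⊕_
infixl 7 _⊗_

_⊕_ : Z2u → Z2u → Z2u
𝟎 ⊕ y = y
x ⊕ 𝟎 = x
𝟏 ⊕ 𝟏 = 𝟎
𝟏 ⊕ 𝐮 = 𝟏+𝐮
𝟏 ⊕ 𝟏+𝐮 = 𝐮
𝐮 ⊕ 𝟏 = 𝟏+𝐮
𝐮 ⊕ 𝐮 = 𝟎
𝐮 ⊕ 𝟏+𝐮 = 𝟏
𝟏+𝐮 ⊕ 𝟏 = 𝐮
𝟏+𝐮 ⊕ 𝐮 = 𝟏
𝟏+𝐮 ⊕ 𝟏+𝐮 = 𝟎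

_⊗_ : Z2u → Z2u → Z2u
𝟎 ⊗ y = 𝟎
𝟏 ⊗ y = y
𝐮 ⊗ 𝟎 = 𝟎
𝐮 ⊗ 𝟏 = 𝐮
𝐮 ⊗ 𝐮 = 𝟎
𝐮 ⊗ 𝟏+𝐮 = 𝐮
𝟏+𝐮 ⊗ 𝟎 = 𝟎
𝟏+𝐮 ⊗ 𝟏 = 𝟏+𝐮
𝟏+𝐮 ⊗ 𝐮 = 𝐮
𝟏+𝐮 ⊗ 𝟏+𝐮 = 𝟏

π : Z2u → Bool
π 𝟎 = false
π 𝐮 = false
π 𝟏 = true
π 𝟏+𝐮 = true

ι : Bool → Z2u
ι false = 𝟎
ι true = 𝟏

Elem : ℕ → ℕ → Set
Elem α β = Vec Bool α × Vec Z2u β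

zeroE : ∀ {α β} → Elem α β
zeroE = replicate _ false , replicate _ 𝟎

_+E_ : ∀ {α β} → Elem α β → Elem α β → Elem α β
(x , x') +E (y , y') = zipWith _xor_ x y , zipWith _⊕_ x' y'

_·E_ : ∀ {α β} → Z2u → Elem α β → Elem α β
λ' ·E (x , x') = map (π λ' ∧_) x , map (λ' ⊗_) x'

record IsAdditiveCode {α β : ℕ} (𝒞 : Elem α β → Set) : Set where
  field
    has-zero : 𝒞 zeroE
    closed-+ : ∀ {x y} → 𝒞 x → 𝒞 y → 𝒞 (x +E y)
    closed-· : ∀ (λ' : Z2u) {x} → 𝒞 x → 𝒞 (λ' ·E x)

sumZ : ∀ {n} → Vec Z2u n → Z2u
sumZ = foldr _ _⊕_ 𝟎

sumB : ∀ {n} → Vec Bool n → Bool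
sumB = foldr _ _xor_ false

innerE : ∀ {α β} → Elem α β → Elem α β → Z2u
innerE (x , x') (y , y') = 𝐮 ⊗ ι (sumB (zipWith _∧_ x y)) ⊕ sumZ (zipWith _⊗_ x' y')

dualE : ∀ {α β} → (Elem α β → Set) → Elem α β → Set
dualE 𝒞 v = ∀ c → 𝒞 c → innerE c v ≡ 𝟎

ψ : Z2u → Vec Bool 2
ψ 𝟎 = false ∷ false ∷ []
ψ 𝟏 = false ∷ true ∷ []
ψ 𝐮 = true ∷ true ∷ []
ψ 𝟏+𝐮 = true ∷ false ∷ []

ψs : ∀ {n} → Vec Z2u n → Vec Bool (n * 2)
ψs x' = concat (map ψ x')

Ψ : ∀ {α β} → Elem α β → Vec Bool (α + β * 2)
Ψ (x , x') = x ++ ψs x'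

ΨImage : ∀ {α β} → (Elem α β → Set) → Vec Bool (α + β * 2) → Set
ΨImage 𝒞 y = Σ (Elem _ _) (λ c → 𝒞 c × Ψ c ≡ y)

dotB : ∀ {n} → Vec Bool n → Vec Bool n → Bool
dotB x y = sumB (zipWith _∧_ x y)

binDual : ∀ {n} → (Vec Bool n → Set) → Vec Bool n → Set
binDual C v = ∀ c → C c → dotB c v ≡ false

-- Let χ z be the second bit of ψ z. A table check shows that the binary dot
-- product of ψ a and ψ b is χ (a ⊗ b), and χ is additive, so Ψ turns the
-- Z2[u]-inner product into the binary one: Ψ c · Ψ v = χ (c · v). This gives
-- Ψ(𝒞⊥) ⊆ C⊥ at once. Conversely, χ alone does not detect 0 (χ (1+u) = 0),
-- but z = 0 as soon as χ z and χ (u z) both vanish; since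
-- 𝒞 is closed under multiplication by 𝐮 and (𝐮 c) · v = 𝐮 (c · v), every
-- preimage of a word of C⊥ (Ψ is onto) lies in 𝒞⊥.
module Submission where

open import Defs
open import Data.Nat using (ℕ; _+_; _*_)
open import Data.Vec using (Vec; []; _∷_; _++_; zipWith; map; concat; splitAt; group)
open import Data.Vec.Properties using (map-∘; map-cong; map-id)
open import Data.Bool using (Bool; true; false; _xor_; _∧_)
open import Data.Bool.Properties using (xor-assoc)
open import Data.Product using (_×_; _,_; ∃)
open import Function using (_∘_; id)
open import Relation.Binary.PropositionalEquality
open ≡-Reasoning

χ : Z2u → Bool
χ 𝟎 = false
χ 𝟏 = true
χ 𝐮 = true
χ 𝟏+𝐮 = false

χ-⊕ : ∀ a b → χ (a ⊕ b) ≡ χ a xor χ b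
χ-⊕ 𝟎 b = refl
χ-⊕ 𝟏 𝟎 = refl
χ-⊕ 𝟏 𝟏 = refl
χ-⊕ 𝟏 𝐮 = refl
χ-⊕ 𝟏 𝟏+𝐮 = refl
χ-⊕ 𝐮 𝟎 = refl
χ-⊕ 𝐮 𝟏 = refl
χ-⊕ 𝐮 𝐮 = refl
χ-⊕ 𝐮 𝟏+𝐮 = refl
χ-⊕ 𝟏+𝐮 𝟎 = refl
χ-⊕ 𝟏+𝐮 𝟏 = refl
χ-⊕ 𝟏+𝐮 𝐮 = refl
χ-⊕ 𝟏+𝐮 𝟏+𝐮 = refl

dotB-ψ : ∀ a b → dotB (ψ a) (ψ b) ≡ χ (a ⊗ b)
dotB-ψ 𝟎 𝟎 = refl
dotB-ψ 𝟎 𝟏 = refl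
dotB-ψ 𝟎 𝐮 = refl
dotB-ψ 𝟎 𝟏+𝐮 = refl
dotB-ψ 𝟏 𝟎 = refl
dotB-ψ 𝟏 𝟏 = refl
dotB-ψ 𝟏 𝐮 = refl
dotB-ψ 𝟏 𝟏+𝐮 = refl
dotB-ψ 𝐮 𝟎 = refl
dotB-ψ 𝐮 𝟏 = refl
dotB-ψ 𝐮 𝐮 = refl
dotB-ψ 𝐮 𝟏+𝐮 = refl
dotB-ψ 𝟏+𝐮 𝟎 = refl
dotB-ψ 𝟏+𝐮 𝟏 = refl
dotB-ψ 𝟏+𝐮 𝐮 = refl
dotB-ψ 𝟏+𝐮 𝟏+𝐮 = refl

χ-𝐮⊗ι : ∀ b → χ (𝐮 ⊗ ι b) ≡ b
χ-𝐮⊗ι false = refl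
χ-𝐮⊗ι true = refl

χ≡false∧χ𝐮⊗≡false⇒≡𝟎 : ∀ z → χ z ≡ false → χ (𝐮 ⊗ z) ≡ false → z ≡ 𝟎
χ≡false∧χ𝐮⊗≡false⇒≡𝟎 𝟎 _ _ = refl
χ≡false∧χ𝐮⊗≡false⇒≡𝟎 𝟏+𝐮 _ ()

𝐮⊗-distrib-⊕ : ∀ a b → 𝐮 ⊗ (a ⊕ b) ≡ 𝐮 ⊗ a ⊕ 𝐮 ⊗ b
𝐮⊗-distrib-⊕ 𝟎 b = refl
𝐮⊗-distrib-⊕ 𝟏 𝟎 = refl
𝐮⊗-distrib-⊕ 𝟏 𝟏 = refl
𝐮⊗-distrib-⊕ 𝟏 𝐮 = refl
𝐮⊗-distrib-⊕ 𝟏 𝟏+𝐮 = refl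
𝐮⊗-distrib-⊕ 𝐮 𝟎 = refl
𝐮⊗-distrib-⊕ 𝐮 𝟏 = refl
𝐮⊗-distrib-⊕ 𝐮 𝐮 = refl
𝐮⊗-distrib-⊕ 𝐮 𝟏+𝐮 = refl
𝐮⊗-distrib-⊕ 𝟏+𝐮 𝟎 = refl
𝐮⊗-distrib-⊕ 𝟏+𝐮 𝟏 = refl
𝐮⊗-distrib-⊕ 𝟏+𝐮 𝐮 = refl
𝐮⊗-distrib-⊕ 𝟏+𝐮 𝟏+𝐮 = refl

𝐮⊗-assoc : ∀ a b → 𝐮 ⊗ a ⊗ b ≡ 𝐮 ⊗ (a ⊗ b)
𝐮⊗-assoc 𝟎 b = refl
𝐮⊗-assoc 𝟏 b = refl
𝐮⊗-assoc 𝐮 𝟎 = refl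
𝐮⊗-assoc 𝐮 𝟏 = refl
𝐮⊗-assoc 𝐮 𝐮 = refl
𝐮⊗-assoc 𝐮 𝟏+𝐮 = refl
𝐮⊗-assoc 𝟏+𝐮 𝟎 = refl
𝐮⊗-assoc 𝟏+𝐮 𝟏 = refl
𝐮⊗-assoc 𝟏+𝐮 𝐮 = refl
𝐮⊗-assoc 𝟏+𝐮 𝟏+𝐮 = refl

𝐮⊗𝐮⊗≡𝟎 : ∀ a → 𝐮 ⊗ (𝐮 ⊗ a) ≡ 𝟎
𝐮⊗𝐮⊗≡𝟎 𝟎 = refl
𝐮⊗𝐮⊗≡𝟎 𝟏 = refl
𝐮⊗𝐮⊗≡𝟎 𝐮 = refl
𝐮⊗𝐮⊗≡𝟎 𝟏+𝐮 = refl

dotB-++ : ∀ {m n} (a c : Vec Bool m) (b d : Vec Bool n) →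
  dotB (a ++ b) (c ++ d) ≡ dotB a c xor dotB b d
dotB-++ [] [] b d = refl
dotB-++ (x ∷ a) (z ∷ c) b d = begin
  (x ∧ z) xor dotB (a ++ b) (c ++ d)       ≡⟨ cong ((x ∧ z) xor_) (dotB-++ a c b d) ⟩
  (x ∧ z) xor (dotB a c xor dotB b d)      ≡⟨ xor-assoc (x ∧ z) (dotB a c) (dotB b d) ⟨
  ((x ∧ z) xor dotB a c) xor dotB b d      ∎

dotB-ψs : ∀ {n} (x y : Vec Z2u n) → dotB (ψs x) (ψs y) ≡ χ (sumZ (zipWith _⊗_ x y))
dotB-ψs [] [] = refl
dotB-ψs (a ∷ x) (b ∷ y) = begin
  dotB (ψ a ++ ψs x) (ψ b ++ ψs y)                ≡⟨ dotB-++ (ψ a) (ψ b) (ψs x) (ψs y) ⟩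
  dotB (ψ a) (ψ b) xor dotB (ψs x) (ψs y)         ≡⟨ cong₂ _xor_ (dotB-ψ a b) (dotB-ψs x y) ⟩
  χ (a ⊗ b) xor χ (sumZ (zipWith _⊗_ x y))        ≡⟨ χ-⊕ (a ⊗ b) _ ⟨
  χ (a ⊗ b ⊕ sumZ (zipWith _⊗_ x y))              ∎

dotB-Ψ : ∀ {α β} (c v : Elem α β) → dotB (Ψ c) (Ψ v) ≡ χ (innerE c v)
dotB-Ψ (x , x') (y , y') = begin
  dotB (x ++ ψs x') (y ++ ψs y')                  ≡⟨ dotB-++ x y (ψs x') (ψs y') ⟩
  dotB x y xor dotB (ψs x') (ψs y')               ≡⟨ cong₂ _xor_ (sym (χ-𝐮⊗ι (dotB x y))) (dotB-ψs x' y') ⟩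
  χ (𝐮 ⊗ ι (dotB x y)) xor χ (sumZ (zipWith _⊗_ x' y'))   ≡⟨ χ-⊕ (𝐮 ⊗ ι (dotB x y)) _ ⟨
  χ (innerE (x , x') (y , y'))                    ∎

dotB-false-∧ : ∀ {n} (x y : Vec Bool n) → dotB (map (false ∧_) x) y ≡ false
dotB-false-∧ [] [] = refl
dotB-false-∧ (a ∷ x) (b ∷ y) = dotB-false-∧ x y

sumZ-𝐮⊗ : ∀ {n} (x y : Vec Z2u n) →
  sumZ (zipWith _⊗_ (map (𝐮 ⊗_) x) y) ≡ 𝐮 ⊗ sumZ (zipWith _⊗_ x y)
sumZ-𝐮⊗ [] [] = refl
sumZ-𝐮⊗ (a ∷ x) (b ∷ y) = begin
  𝐮 ⊗ a ⊗ b ⊕ sumZ (zipWith _⊗_ (map (𝐮 ⊗_) x) y)  ≡⟨ cong₂ _⊕_ (𝐮⊗-assoc a b) (sumZ-𝐮⊗ x y) ⟩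
  𝐮 ⊗ (a ⊗ b) ⊕ 𝐮 ⊗ sumZ (zipWith _⊗_ x y)         ≡⟨ 𝐮⊗-distrib-⊕ (a ⊗ b) _ ⟨
  𝐮 ⊗ (a ⊗ b ⊕ sumZ (zipWith _⊗_ x y))             ∎

innerE-𝐮·E : ∀ {α β} (c v : Elem α β) → innerE (𝐮 ·E c) v ≡ 𝐮 ⊗ innerE c v
innerE-𝐮·E (x , x') (y , y') = begin
  𝐮 ⊗ ι (dotB (map (false ∧_) x) y) ⊕ sumZ (zipWith _⊗_ (map (𝐮 ⊗_) x') y')
      ≡⟨ cong₂ (λ b s → 𝐮 ⊗ ι b ⊕ s) (dotB-false-∧ x y) (sumZ-𝐮⊗ x' y') ⟩
  𝐮 ⊗ sumZ (zipWith _⊗_ x' y')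
      ≡⟨ cong (_⊕ 𝐮 ⊗ sumZ (zipWith _⊗_ x' y')) (𝐮⊗𝐮⊗≡𝟎 (ι (dotB x y))) ⟨
  𝐮 ⊗ (𝐮 ⊗ ι (dotB x y)) ⊕ 𝐮 ⊗ sumZ (zipWith _⊗_ x' y')
      ≡⟨ 𝐮⊗-distrib-⊕ (𝐮 ⊗ ι (dotB x y)) _ ⟨
  𝐮 ⊗ innerE (x , x') (y , y')
      ∎

ψ⁻¹ : Vec Bool 2 → Z2u
ψ⁻¹ (false ∷ false ∷ []) = 𝟎
ψ⁻¹ (false ∷ true ∷ []) = 𝟏
ψ⁻¹ (true ∷ true ∷ []) = 𝐮
ψ⁻¹ (true ∷ false ∷ []) = 𝟏+𝐮

ψ∘ψ⁻¹ : ∀ p → ψ (ψ⁻¹ p) ≡ p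
ψ∘ψ⁻¹ (false ∷ false ∷ []) = refl
ψ∘ψ⁻¹ (false ∷ true ∷ []) = refl
ψ∘ψ⁻¹ (true ∷ true ∷ []) = refl
ψ∘ψ⁻¹ (true ∷ false ∷ []) = refl

ψs-surjective : ∀ {n} (w : Vec Bool (n * 2)) → ∃ λ x → ψs x ≡ w
ψs-surjective {n} w with group n 2 w
... | pairs , w≡concat = map ψ⁻¹ pairs , (begin
  concat (map ψ (map ψ⁻¹ pairs))   ≡⟨ cong concat (map-∘ ψ ψ⁻¹ pairs) ⟨
  concat (map (ψ ∘ ψ⁻¹) pairs)     ≡⟨ cong concat (map-cong ψ∘ψ⁻¹ pairs) ⟩
  concat (map id pairs)            ≡⟨ cong concat (map-id pairs) ⟩
  concat pairs                     ≡⟨ w≡concat ⟨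
  w                                ∎)

Ψ-surjective : ∀ {α β} (w : Vec Bool (α + β * 2)) → ∃ λ (v : Elem α β) → Ψ v ≡ w
Ψ-surjective {α} {β} w with splitAt α w
... | x , w' , refl with ψs-surjective {β} w'
...   | x' , refl = (x , x') , refl

corollary1 : {α β : ℕ} (𝒞 : Elem α β → Set) → IsAdditiveCode 𝒞 →
    (y : Vec Bool (α + β * 2)) →
    (ΨImage (dualE 𝒞) y → binDual (ΨImage 𝒞) y) × (binDual (ΨImage 𝒞) y → ΨImage (dualE 𝒞) y)
corollary1 {α} {β} 𝒞 code y = image-dual⊆dual-image , dual-image⊆image-dual
  where
  open IsAdditiveCode code

  image-dual⊆dual-image : ΨImage (dualE 𝒞) y → binDual (ΨImage 𝒞) y
  image-dual⊆dual-image (v , v⊥ , refl) _ (c , c∈𝒞 , refl) =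
    trans (dotB-Ψ c v) (cong χ (v⊥ c c∈𝒞))

  dual-image⊆image-dual : binDual (ΨImage 𝒞) y → ΨImage (dualE 𝒞) y
  dual-image⊆image-dual y⊥ with Ψ-surjective {α} {β} y
  ... | v , refl = v , v⊥ , refl
    where
    χ-inner≡false : ∀ c → 𝒞 c → χ (innerE c v) ≡ false
    χ-inner≡false c c∈𝒞 = trans (sym (dotB-Ψ c v)) (y⊥ (Ψ c) (c , c∈𝒞 , refl))

    v⊥ : dualE 𝒞 v
    v⊥ c c∈𝒞 = χ≡false∧χ𝐮⊗≡false⇒≡𝟎 (innerE c v) (χ-inner≡false c c∈𝒞)
      (trans (cong χ (sym (innerE-𝐮·E c v))) (χ-inner≡false (𝐮 ·E c) (closed-· 𝐮 c∈𝒞)))
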